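{- Let $m,n\in\mathbb N^+$ and $G=(V,E)$ a graph. Let $A,B\subseteq V$ be disjoint such that $|N(u)\cap B|\ge 1$ for every $u\in A$. If $|A|>(m-1)(n-1)$, then (i) there are $m$ vertices $u_1,\dots,u_m$ in $A$ and a vertex $v\in B$ with $\{u_i,v\}\in E$ for every $i\in[m]$, or (ii) there are $n$ vertices $u_1,\dots,u_n$ in $A$ and $n$ vertices $v_1,\dots,v_n$ in $B$ such that for all $i,j\in[n]$, $\{u_i,v_j\}\in E$ iff $i=j$.
   Context: Graphs are simple and finite. $N(u)$ is the set of neighbours of $u$ in $G$. -}

module Defs where

open import Data.Nat using (ℕ)
open import Data.Fin using (Fin)
open import Data.Bool using (Bool; true; false)
open import Data.Product using (_×_; Σ; ∃)
open import Data.Fin.Subset using (Subset; _∈_; Empty; _∩_)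
open import Relation.Binary.PropositionalEquality using (_≡_; _≢_)
open import Relation.Nullary using (¬_)
open import Function.Definitions using (Injective)

record Graph (k : ℕ) : Set where
  field
    adj     : Fin k → Fin k → Bool
    symm    : ∀ u v → adj u v ≡ adj v u
    irrefl  : ∀ u → adj u u ≡ false

Edge : ∀ {k} → Graph k → Fin k → Fin k → Set
Edge G u v = Graph.adj G u v ≡ true

Disjoint : ∀ {k} → Subset k → Subset k → Set
Disjoint A B = ∀ v → v ∈ A → ¬ (v ∈ B)

HasNbrIn : ∀ {k} → Graph k → Subset k → Fin k → Set
HasNbrIn G B u = ∃ λ v → v ∈ B × Edge G u v

Star : ∀ {k : ℕ} → Graph k → Subset k → Subset k → ℕ → Set
Star {k} G A B m =
  Σ (Fin m → Fin k) λ u → Injective _≡_ _≡_ u × (∀ i → u i ∈ A) ×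
  ∃ λ v → v ∈ B × (∀ i → Edge G (u i) v)

InducedMatching : ∀ {k} → Graph k → Subset k → Subset k → ℕ → Set
InducedMatching {k} G A B n =
  Σ (Fin n → Fin k) λ u → Σ (Fin n → Fin k) λ v →
    Injective _≡_ _≡_ u × Injective _≡_ _≡_ v ×
    (∀ i → u i ∈ A) × (∀ i → v i ∈ B) ×
    (∀ i j → (Edge G (u i) (v j) → i ≡ j) × (i ≡ j → Edge G (u i) (v j)))

-- Choose u ∈ A with the fewest neighbours in B and a neighbour v ∈ B of u.
-- If v has m neighbours in A they form the star (i). Otherwise keep the edge uv,
-- delete the fewer than m neighbours of v from A and the neighbours of u from B:
-- this costs at most m - 1 vertices of A, and every remaining w ∈ A still has a
-- neighbour in B, because w misses v and has at least as many neighbours in B as u.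
-- After n - 1 rounds the chosen edges form the induced matching (ii).
module Submission where

open import Defs
open import Data.Nat using (ℕ; suc; _*_; _∸_; _<_; NonZero)
open import Data.Fin using (Fin)
open import Data.Fin.Subset using (Subset; _∈_; ∣_∣)
open import Data.Sum using (_⊎_)

open import Data.Nat using (zero; _+_; _≤_; _≤?_; z≤n)
open import Data.Nat.Properties
  using (+-suc; *-suc; >⇒≢; <⇒≱; ≰⇒>; ≤-<-trans; ∸-monoˡ-≤; +-monoˡ-≤; +-cancelˡ-<; module ≤-Reasoning)
open import Data.Fin using (zero; suc; inject≤)
open import Data.Fin.Properties using (suc-injective; inject≤-injective)
open import Data.Fin.Subset using (inside; outside; _∉_; _⊆_; _∩_; _─_; Nonempty)
open import Data.Fin.Subset.Properties
  using (_∈?_; nonempty?; Empty-unique; ∣⊥∣≡0; p⊂q⇒∣p∣<∣q∣; x∈p∧x∉q⇒x∈p─q; p─q⊆p; p∩q⊆p; p∩q⊆q; x∈p∩q⁺)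
open import Data.Vec using ([]; _∷_; here; there; tabulate)
open import Data.Vec.Properties using ([]=⇒lookup; lookup⇒[]=; lookup∘tabulate)
open import Data.Vec.Functional as Vector using (Vector)
open import Data.List using (List; filter; allFin)
open import Data.List.Extrema.Nat using (argmin; argmin-all; f[argmin]≤f[xs])
open import Data.List.Relation.Unary.All as All using ()
open import Data.List.Relation.Unary.All.Properties using (all-filter)
open import Data.List.Membership.Propositional.Properties using (∈-filter⁺; ∈-allFin)
open import Data.Product as Product using (Σ; ∃; _×_; _,_; proj₁; proj₂)
open import Data.Sum as Sum using (inj₁; inj₂)
open import Function using (_∘_)
open import Function.Definitions using (Injective)
open import Relation.Binary.PropositionalEquality
open import Relation.Nullary using (¬_; Dec; yes; no)
open import Relation.Nullary.Negation using (contradiction)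

private
  variable
    k n : ℕ

x∈p─q⇒x∉q : {p q : Subset k} {x : Fin k} → x ∈ p ─ q → x ∉ q
x∈p─q⇒x∉q {p = _ ∷ _} {q = inside ∷ _} () here
x∈p─q⇒x∉q {p = _ ∷ _} {q = _ ∷ _} (there x∈p─q) (there x∈q) = x∈p─q⇒x∉q x∈p─q x∈q

∣p∣≡∣p∩q∣+∣p─q∣ : (p q : Subset k) → ∣ p ∣ ≡ ∣ p ∩ q ∣ + ∣ p ─ q ∣
∣p∣≡∣p∩q∣+∣p─q∣ [] [] = refl
∣p∣≡∣p∩q∣+∣p─q∣ (inside ∷ p) (inside ∷ q) = cong suc (∣p∣≡∣p∩q∣+∣p─q∣ p q)
∣p∣≡∣p∩q∣+∣p─q∣ (inside ∷ p) (outside ∷ q) = trans (cong suc (∣p∣≡∣p∩q∣+∣p─q∣ p q)) (sym (+-suc _ _))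
∣p∣≡∣p∩q∣+∣p─q∣ (outside ∷ p) (inside ∷ q) = ∣p∣≡∣p∩q∣+∣p─q∣ p q
∣p∣≡∣p∩q∣+∣p─q∣ (outside ∷ p) (outside ∷ q) = ∣p∣≡∣p∩q∣+∣p─q∣ p q

0<∣p∣⇒Nonempty : {p : Subset k} → 0 < ∣ p ∣ → Nonempty p
0<∣p∣⇒Nonempty {k} {p} 0<∣p∣ with nonempty? p
... | yes p≢∅ = p≢∅
... | no p≡∅ = contradiction (trans (cong ∣_∣ (Empty-unique p≡∅)) (∣⊥∣≡0 k)) (>⇒≢ 0<∣p∣)

q⊈p∧∣q∣≤∣p∣⇒p─q≢∅ : {p q : Subset k} {x : Fin k} → x ∈ q → x ∉ p → ∣ q ∣ ≤ ∣ p ∣ → Nonempty (p ─ q)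
q⊈p∧∣q∣≤∣p∣⇒p─q≢∅ {p = p} {q} {x} x∈q x∉p ∣q∣≤∣p∣ with nonempty? (p ─ q)
... | yes p─q≢∅ = p─q≢∅
... | no p─q≡∅ = contradiction ∣q∣≤∣p∣ (<⇒≱ (p⊂q⇒∣p∣<∣q∣ (p⊆q , x , x∈q , x∉p)))
  where
  p⊆q : p ⊆ q
  p⊆q {y} y∈p with y ∈? q
  ... | yes y∈q = y∈q
  ... | no y∉q = contradiction (y , x∈p∧x∉q⇒x∈p─q y∈p y∉q) p─q≡∅

enumerate : (p : Subset k) → Fin ∣ p ∣ → Fin k
enumerate (inside ∷ p) zero = zero
enumerate (inside ∷ p) (suc i) = suc (enumerate p i)
enumerate (outside ∷ p) i = suc (enumerate p i)

enumerate-injective : (p : Subset k) → Injective _≡_ _≡_ (enumerate p)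
enumerate-injective (inside ∷ p) {zero} {zero} _ = refl
enumerate-injective (inside ∷ p) {suc i} {suc j} eq = cong suc (enumerate-injective p (suc-injective eq))
enumerate-injective (outside ∷ p) eq = enumerate-injective p (suc-injective eq)

enumerate-∈ : (p : Subset k) (i : Fin ∣ p ∣) → enumerate p i ∈ p
enumerate-∈ (inside ∷ p) zero = here
enumerate-∈ (inside ∷ p) (suc i) = there (enumerate-∈ p i)
enumerate-∈ (outside ∷ p) i = there (enumerate-∈ p i)

choose-distinct : {n : ℕ} {p : Subset k} → n ≤ ∣ p ∣
  → Σ (Fin n → Fin k) λ f → Injective _≡_ _≡_ f × (∀ i → f i ∈ p)
choose-distinct {n = n} {p = p} n≤∣p∣ =
  enumerate p ∘ ι ,
  (λ {i} {j} eq → inject≤-injective n≤∣p∣ n≤∣p∣ i j (enumerate-injective p eq)) ,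
  enumerate-∈ p ∘ ι
  where
  ι : Fin n → Fin ∣ p ∣
  ι i = inject≤ i n≤∣p∣

minimiser : (f : Fin k → ℕ) {p : Subset k} → Nonempty p
  → ∃ λ x → x ∈ p × (∀ {y} → y ∈ p → f x ≤ f y)
minimiser {k} f {p} (x₀ , x₀∈p) =
  argmin f x₀ xs ,
  argmin-all f x₀∈p (all-filter (_∈? p) (allFin k)) ,
  λ y∈p → All.lookup (f[argmin]≤f[xs] x₀ xs) (∈-filter⁺ (_∈? p) (∈-allFin _) y∈p)
  where
  xs : List (Fin k)
  xs = filter (_∈? p) (allFin k)

cons-injective : {A : Set} {x : A} {f : Vector A n} → (∀ i → f i ≢ x)
  → Injective _≡_ _≡_ f → Injective _≡_ _≡_ (x Vector.∷ f)
cons-injective _ _ {zero} {zero} _ = refl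
cons-injective x∉f _ {zero} {suc j} x≡fj = contradiction (sym x≡fj) (x∉f j)
cons-injective x∉f _ {suc i} {zero} fi≡x = contradiction fi≡x (x∉f i)
cons-injective _ f-inj {suc i} {suc j} eq = cong suc (f-inj eq)

module _ (G : Graph k) where

  open Graph G using (adj; symm)

  N : Fin k → Subset k
  N u = tabulate (adj u)

  Edge-sym : {u v : Fin k} → Edge G u v → Edge G v u
  Edge-sym {u} {v} uv = trans (symm v u) uv

  ∈N⇒Edge : {u x : Fin k} → x ∈ N u → Edge G u x
  ∈N⇒Edge {u} {x} x∈Nu = trans (sym (lookup∘tabulate (adj u) x)) ([]=⇒lookup x∈Nu)

  Edge⇒∈N : {u x : Fin k} → Edge G u x → x ∈ N u
  Edge⇒∈N {u} {x} ux = lookup⇒[]= x (N u) (trans (lookup∘tabulate (adj u) x) ux)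

  ∉N⇒¬Edge : {u x : Fin k} → x ∉ N u → ¬ Edge G x u
  ∉N⇒¬Edge x∉Nu xu = x∉Nu (Edge⇒∈N (Edge-sym xu))

  Star-mono : {A A′ B B′ : Subset k} {m : ℕ} → A ⊆ A′ → B ⊆ B′ → Star G A B m → Star G A′ B′ m
  Star-mono A⊆A′ B⊆B′ (u , u-inj , u∈A , v , v∈B , uv) = u , u-inj , A⊆A′ ∘ u∈A , v , B⊆B′ v∈B , uv

  star-at : {A B : Subset k} {m : ℕ} {v : Fin k} → m ≤ ∣ A ∩ N v ∣ → v ∈ B → Star G A B m
  star-at {A} {v = v} m≤deg v∈B with choose-distinct m≤deg
  ... | u , u-inj , u∈A∩Nv =
    u , u-inj , p∩q⊆p A (N v) ∘ u∈A∩Nv , v , v∈B , Edge-sym ∘ ∈N⇒Edge ∘ p∩q⊆q A (N v) ∘ u∈A∩Nv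

  empty-matching : {A B : Subset k} → InducedMatching G A B 0
  empty-matching = (λ ()) , (λ ()) , (λ {}) , (λ {}) , (λ ()) , (λ ()) , λ ()

  extend-matching : {A B : Subset k} {u v : Fin k} → u ∈ A → v ∈ B → Edge G u v
    → InducedMatching G (A ─ N v) (B ─ N u) n → InducedMatching G A B (suc n)
  extend-matching {A = A} {B} {u} {v} u∈A v∈B uv (us , vs , us-inj , vs-inj , us∈ , vs∈ , induced) =
    us′ , vs′ , cons-injective us≢u us-inj , cons-injective vs≢v vs-inj , us′∈A , vs′∈B , induced′
    where
    us′ vs′ : Vector (Fin k) _
    us′ = u Vector.∷ us
    vs′ = v Vector.∷ vs

    ¬us-v : ∀ i → ¬ Edge G (us i) v
    ¬us-v i = ∉N⇒¬Edge (x∈p─q⇒x∉q (us∈ i))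

    ¬u-vs : ∀ j → ¬ Edge G u (vs j)
    ¬u-vs j = x∈p─q⇒x∉q (vs∈ j) ∘ Edge⇒∈N

    us≢u : ∀ i → us i ≢ u
    us≢u i refl = ¬us-v i uv

    vs≢v : ∀ j → vs j ≢ v
    vs≢v j refl = ¬u-vs j uv

    us′∈A : ∀ i → us′ i ∈ A
    us′∈A zero = u∈A
    us′∈A (suc i) = p─q⊆p A (N v) (us∈ i)

    vs′∈B : ∀ j → vs′ j ∈ B
    vs′∈B zero = v∈B
    vs′∈B (suc j) = p─q⊆p B (N u) (vs∈ j)

    induced′ : ∀ i j → (Edge G (us′ i) (vs′ j) → i ≡ j) × (i ≡ j → Edge G (us′ i) (vs′ j))
    induced′ zero zero = (λ _ → refl) , λ _ → uv
    induced′ zero (suc j) = (λ e → contradiction e (¬u-vs j)) , λ ()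
    induced′ (suc i) zero = (λ e → contradiction e (¬us-v i)) , λ ()
    induced′ (suc i) (suc j) = Product.map (cong suc ∘_) (_∘ suc-injective) (induced i j)

  record Pivot (A B : Subset k) : Set where
    field
      u v : Fin k
      u∈A : u ∈ A
      v∈B : v ∈ B
      uv : Edge G u v
      nbr′ : ∀ w → w ∈ A ─ N v → HasNbrIn G (B ─ N u) w

  minimum-degree-pivot : {A B : Subset k} → Nonempty A → (∀ u → u ∈ A → HasNbrIn G B u) → Pivot A B
  minimum-degree-pivot {A} {B} A≢∅ nbr with minimiser (λ w → ∣ B ∩ N w ∣) A≢∅
  ... | u , u∈A , u-min with nbr u u∈A
  ... | v , v∈B , uv = record { u = u ; v = v ; u∈A = u∈A ; v∈B = v∈B ; uv = uv ; nbr′ = nbr′ }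
    where
    nbr′ : ∀ w → w ∈ A ─ N v → HasNbrIn G (B ─ N u) w
    nbr′ w w∈A─Nv = x , x∈p∧x∉q⇒x∈p─q (p∩q⊆p B (N w) x∈B∩Nw) x∉Nu , ∈N⇒Edge (p∩q⊆q B (N w) x∈B∩Nw)
      where
      v∈B∩Nu : v ∈ B ∩ N u
      v∈B∩Nu = x∈p∩q⁺ (v∈B , Edge⇒∈N uv)

      v∉B∩Nw : v ∉ B ∩ N w
      v∉B∩Nw v∈B∩Nw = ∉N⇒¬Edge (x∈p─q⇒x∉q w∈A─Nv) (∈N⇒Edge (p∩q⊆q B (N w) v∈B∩Nw))

      escape : Nonempty ((B ∩ N w) ─ (B ∩ N u))
      escape = q⊈p∧∣q∣≤∣p∣⇒p─q≢∅ v∈B∩Nu v∉B∩Nw (u-min (p─q⊆p A (N v) w∈A─Nv))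

      x : Fin k
      x = proj₁ escape

      x∈B∩Nw : x ∈ B ∩ N w
      x∈B∩Nw = p─q⊆p (B ∩ N w) (B ∩ N u) (proj₂ escape)

      x∉Nu : x ∉ N u
      x∉Nu x∈Nu = x∈p─q⇒x∉q (proj₂ escape) (x∈p∩q⁺ (p∩q⊆p B (N w) x∈B∩Nw , x∈Nu))

  star-or-matching : (m n : ℕ) {A B : Subset k} → (∀ u → u ∈ A → HasNbrIn G B u)
    → (m ∸ 1) * n < ∣ A ∣ → Star G A B m ⊎ InducedMatching G A B (suc n)
  star-or-matching m n {A} {B} nbr large = star-or-rest (m ≤? ∣ A ∩ N v ∣)
    where
    open Pivot (minimum-degree-pivot (0<∣p∣⇒Nonempty (≤-<-trans z≤n large)) nbr)

    rest : ∀ j → (m ∸ 1) * j < ∣ A ∣ → ∣ A ∩ N v ∣ ≤ m ∸ 1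
      → Star G (A ─ N v) (B ─ N u) m ⊎ InducedMatching G (A ─ N v) (B ─ N u) j
    rest zero _ _ = inj₂ empty-matching
    rest (suc j) large′ deg≤m∸1 = star-or-matching m j nbr′ (+-cancelˡ-< (m ∸ 1) _ _ (begin-strict
      (m ∸ 1) + (m ∸ 1) * j          ≡⟨ *-suc (m ∸ 1) j ⟨
      (m ∸ 1) * suc j                <⟨ large′ ⟩
      ∣ A ∣                          ≡⟨ ∣p∣≡∣p∩q∣+∣p─q∣ A (N v) ⟩
      ∣ A ∩ N v ∣ + ∣ A ─ N v ∣      ≤⟨ +-monoˡ-≤ ∣ A ─ N v ∣ deg≤m∸1 ⟩
      (m ∸ 1) + ∣ A ─ N v ∣          ∎))
      where open ≤-Reasoning

    star-or-rest : Dec (m ≤ ∣ A ∩ N v ∣) → Star G A B m ⊎ InducedMatching G A B (suc n)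
    star-or-rest (yes m≤deg) = inj₁ (star-at m≤deg v∈B)
    star-or-rest (no m≰deg) =
      Sum.map (Star-mono (p─q⊆p A (N v)) (p─q⊆p B (N u))) (extend-matching u∈A v∈B uv)
              (rest n large (∸-monoˡ-≤ 1 (≰⇒> m≰deg)))

lemma3p10 : (m n k : ℕ) → .{{NonZero m}} → .{{NonZero n}} → (G : Graph k)
    → (A B : Subset k) → Disjoint A B
    → (∀ u → u ∈ A → HasNbrIn G B u)
    → (m ∸ 1) * (n ∸ 1) < ∣ A ∣
    → Star G A B m ⊎ InducedMatching G A B n
lemma3p10 m (suc n) k G A B _ nbr large = star-or-matching G m n nbr large
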